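{- Let $T$ be a tree. If $F$ is a minimal fort of $T$, then $F$ does not contain three vertices $a,b,c$ with $a\sim b$ and $b\sim c$.
   Context: $x\sim y$ means $x$ and $y$ are adjacent. A fort of a graph is a nonempty set $F$ of vertices such that every vertex not in $F$ is adjacent to either zero or at least two vertices of $F$; it is minimal if no proper subset is a fort. -}

module Defs where

open import Data.Nat using (ℕ; zero; suc; _≤_; _+_)
open import Data.Fin using (Fin)
open import Data.Fin.Subset using (Subset; _∈_; _∉_; _⊂_; Nonempty)
open import Data.List using (List; []; _∷_; length; filter; head; last)
open import Data.List.Relation.Unary.Unique.Propositional using (Unique)
open import Data.Maybe using (just)
open import Data.Product using (Σ; _×_; ∃; ∃-syntax)
open import Relation.Binary.PropositionalEquality using (_≡_)
open import Relation.Nullary using (¬_)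
open import Data.Fin.Subset.Properties using (_∈?_)
open import Data.Vec.Functional using ()
open import Data.List using (allFin)
open import Data.List.Base using (filterᵇ)
open import Data.Bool using (Bool; _∧_; true; if_then_else_)

record Graph (n : ℕ) : Set where
  field
    adj   : Fin n → Fin n → Bool
    sym   : ∀ x y → adj x y ≡ adj y x
    irrefl : ∀ x → adj x x ≡ Data.Bool.false

open Graph public

_⊢_∼_ : ∀ {n} → Graph n → Fin n → Fin n → Set
G ⊢ x ∼ y = adj G x y ≡ true

data IsWalk {n} (G : Graph n) : List (Fin n) → Set where
  single : ∀ x → IsWalk G (x ∷ [])
  step   : ∀ {x y ws} → G ⊢ x ∼ y → IsWalk G (y ∷ ws) → IsWalk G (x ∷ y ∷ ws)

Connected : ∀ {n} → Graph n → Set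
Connected {n} G = ∀ (x y : Fin n) → ∃[ w ] (IsWalk G w × head w ≡ just x × last w ≡ just y)

IsCycle : ∀ {n} → Graph n → List (Fin n) → Set
IsCycle G [] = Data.Empty.⊥ where import Data.Empty
IsCycle G (x ∷ ws) =
  IsWalk G (x ∷ ws) × Unique (x ∷ ws) × 3 ≤ length (x ∷ ws)
  × ∃[ y ] (last (x ∷ ws) ≡ just y × G ⊢ y ∼ x)

Acyclic : ∀ {n} → Graph n → Set
Acyclic {n} G = ∀ (c : List (Fin n)) → ¬ IsCycle G c

IsTree : ∀ {n} → Graph n → Set
IsTree {n} G = 1 ≤ n × Connected G × Acyclic G

nbrsIn : ∀ {n} → Graph n → Subset n → Fin n → ℕ
nbrsIn {n} G F v = length (filterᵇ (λ u → adj G v u ∧ Data.Vec.lookup F u) (allFin n))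
  where import Data.Vec

IsFort : ∀ {n} → Graph n → Subset n → Set
IsFort {n} G F = Nonempty F × (∀ (v : Fin n) → v ∉ F → (nbrsIn G F v ≡ 0 ⊎ 2 ≤ nbrsIn G F v))
  where open import Data.Sum using (_⊎_)

IsMinimalFort : ∀ {n} → Graph n → Subset n → Set
IsMinimalFort G F = IsFort G F × (∀ F′ → F′ ⊂ F → ¬ IsFort G F′)

{-# OPTIONS --safe #-}
module Submission where

-- Let b ∈ F have neighbours a ≠ c in F. Deleting b splits the tree into branches, each
-- attached to b through a unique neighbour of b, its root (uniqueness is acyclicity).
-- Keep only the part of F lying in branches whose root belongs to F. A vertex outside
-- these branches other than b sees none of it; a vertex inside them but not in F is not
-- a root, so not adjacent to b, and sees exactly its neighbours in F; b still sees a
-- and c. So this is a fort, and a proper subset of F since it misses b.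

open import Defs
open import Data.Bool using (T; _∧_)
open import Data.Bool.Properties using (T-∧; T-≡)
open import Data.Empty using (⊥-elim)
open import Data.Fin using (Fin; _≟_)
open import Data.Fin.Subset using (Subset; _∈_; _∉_; _∩_; Nonempty)
open import Data.Fin.Subset.Properties using (_∈?_; x∈p∩q⁺; x∈p∩q⁻; p∩q⊆p)
open import Data.List using (List; []; _∷_; length; last; allFin)
import Data.List.Membership.Propositional as List
open import Data.List.Membership.Propositional.Properties using (∈-allFin; ∈-filter⁺; ∈-length)
open import Data.List.Properties using (filter-none; filter-≐)
open import Data.List.Relation.Unary.All as All using (All; []; _∷_)
open import Data.List.Relation.Unary.All.Properties using (¬Any⇒All¬)
open import Data.List.Relation.Unary.AllPairs using ([]; _∷_)
open import Data.List.Relation.Unary.Any as Any using (here; there)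
open import Data.List.Relation.Unary.Unique.Propositional using (Unique)
open import Data.Maybe using (just)
open import Data.Maybe.Properties using (just-injective)
open import Data.Nat using (_≤_; s≤s; z≤n)
open import Data.Nat.Properties using (m≤n⇒m≤1+n)
open import Data.Product using (_×_; _,_; proj₁; proj₂; ∃-syntax)
open import Data.Sum using (_⊎_; inj₁; inj₂)
open import Data.Vec using (tabulate; lookup)
open import Data.Vec.Properties using (lookup∘tabulate; []=⇒lookup; lookup⇒[]=)
open import Function using (_∘_; _⇔_; mk⇔; Equivalence)
open import Level using (0ℓ)
open import Relation.Binary using (Rel; Symmetric)
open import Relation.Binary.Construct.Closure.ReflexiveTransitive using (Star; ε; _◅_; _◅◅_; reverse)
open import Relation.Binary.PropositionalEquality using (_≡_; _≢_; refl; trans; subst; cong; ≢-sym)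
import Relation.Binary.PropositionalEquality as ≡
open import Relation.Nullary using (¬_; yes; no; does; contradiction; ¬?)
open import Relation.Nullary.Decidable using (T?; dec-true; _×-dec_)
open import Relation.Unary using (Pred; Decidable)

distinct-∈⇒2≤length : ∀ {a} {A : Set a} {x y : A} {xs : List A} →
  x List.∈ xs → y List.∈ xs → x ≢ y → 2 ≤ length xs
distinct-∈⇒2≤length (here refl)  (here refl)  x≢y = contradiction refl x≢y
distinct-∈⇒2≤length (here _)     (there y∈xs) _   = s≤s (∈-length y∈xs)
distinct-∈⇒2≤length (there x∈xs) (here _)     _   = s≤s (∈-length x∈xs)
distinct-∈⇒2≤length (there x∈xs) (there y∈xs) x≢y = m≤n⇒m≤1+n (distinct-∈⇒2≤length x∈xs y∈xs x≢y)

module _ {n ℓ} {P : Pred (Fin n) ℓ} (P? : Decidable P) where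

  subsetOf : Subset n
  subsetOf = tabulate (does ∘ P?)

  ∈-subsetOf⁺ : ∀ {x} → P x → x ∈ subsetOf
  ∈-subsetOf⁺ {x} px = lookup⇒[]= x subsetOf (trans (lookup∘tabulate (does ∘ P?) x) (dec-true (P? x) px))

  ∈-subsetOf⁻ : ∀ {x} → x ∈ subsetOf → P x
  ∈-subsetOf⁻ {x} x∈ with P? x | trans (≡.sym (lookup∘tabulate (does ∘ P?) x)) ([]=⇒lookup x∈)
  ... | yes px | _  = px
  ... | no _   | ()

module _ {n} (G : Graph n) where

  ∼-sym : ∀ {u v} → G ⊢ u ∼ v → G ⊢ v ∼ u
  ∼-sym {u} {v} u∼v = trans (sym G v u) u∼v

  ∼⇒≢ : ∀ {u v} → G ⊢ u ∼ v → u ≢ v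
  ∼⇒≢ {u} u∼u refl with trans (≡.sym u∼u) (irrefl G u)
  ... | ()

  counted⇔ : ∀ {F v u} → T (adj G v u ∧ lookup F u) ⇔ (G ⊢ v ∼ u × u ∈ F)
  counted⇔ {F} {v} {u} = mk⇔ to from
    where
    to : T (adj G v u ∧ lookup F u) → G ⊢ v ∼ u × u ∈ F
    to t = let tv , tF = Equivalence.to T-∧ t in
      Equivalence.to T-≡ tv , lookup⇒[]= u F (Equivalence.to T-≡ tF)
    from : G ⊢ v ∼ u × u ∈ F → T (adj G v u ∧ lookup F u)
    from (v∼u , u∈F) = Equivalence.from T-∧ (Equivalence.from T-≡ v∼u , Equivalence.from T-≡ ([]=⇒lookup u∈F))

  nbrsIn≡0 : ∀ {F v} → (∀ {u} → G ⊢ v ∼ u → u ∉ F) → nbrsIn G F v ≡ 0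
  nbrsIn≡0 {F} {v} none = cong length (filter-none (T? ∘ λ u → adj G v u ∧ lookup F u)
    (All.universal (λ u t → let v∼u , u∈F = Equivalence.to counted⇔ t in none v∼u u∈F) (allFin n)))

  2≤nbrsIn : ∀ {F v a c} → a ≢ c → G ⊢ v ∼ a → G ⊢ v ∼ c → a ∈ F → c ∈ F → 2 ≤ nbrsIn G F v
  2≤nbrsIn {a = a} {c} a≢c v∼a v∼c a∈F c∈F = distinct-∈⇒2≤length
    (∈-filter⁺ _ (∈-allFin a) (Equivalence.from counted⇔ (v∼a , a∈F)))
    (∈-filter⁺ _ (∈-allFin c) (Equivalence.from counted⇔ (v∼c , c∈F)))
    a≢c

  nbrsIn-cong : ∀ {F F′ v} → (∀ {u} → G ⊢ v ∼ u → u ∈ F ⇔ u ∈ F′) → nbrsIn G F v ≡ nbrsIn G F′ v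
  nbrsIn-cong {F} {F′} {v} same = cong length
    (filter-≐ (T? ∘ λ u → adj G v u ∧ lookup F u) (T? ∘ λ u → adj G v u ∧ lookup F′ u)
      (transport (Equivalence.to ∘ same) , transport (Equivalence.from ∘ same)) (allFin n))
    where
    transport : ∀ {X Y : Subset n} → (∀ {u} → G ⊢ v ∼ u → u ∈ X → u ∈ Y) →
      ∀ {u} → T (adj G v u ∧ lookup X u) → T (adj G v u ∧ lookup Y u)
    transport X⇒Y t = let v∼u , u∈X = Equivalence.to counted⇔ t in
      Equivalence.from counted⇔ (v∼u , X⇒Y v∼u u∈X)

  ∩-isFort : ∀ {F S b} → IsFort G F →
    (∀ {u v} → u ∈ S → G ⊢ u ∼ v → v ≢ b → v ∈ S) →
    (∀ {v} → v ∈ S → G ⊢ v ∼ b → v ∈ F) →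
    Nonempty (F ∩ S) →
    nbrsIn G (F ∩ S) b ≡ 0 ⊎ 2 ≤ nbrsIn G (F ∩ S) b →
    IsFort G (F ∩ S)
  ∩-isFort {F} {S} {b} (_ , fort) closed attached∈F nonempty atB = nonempty , condition
    where
    condition : ∀ v → v ∉ F ∩ S → nbrsIn G (F ∩ S) v ≡ 0 ⊎ 2 ≤ nbrsIn G (F ∩ S) v
    condition v v∉F∩S with v ≟ b | v ∈? S
    ... | yes refl | _       = atB
    ... | no v≢b   | no v∉S  = inj₁ (nbrsIn≡0 λ v∼u u∈F∩S →
      v∉S (closed (proj₂ (x∈p∩q⁻ F S u∈F∩S)) (∼-sym v∼u) v≢b))
    ... | no v≢b   | yes v∈S = subst (λ k → k ≡ 0 ⊎ 2 ≤ k) (nbrsIn-cong same) (fort v v∉F)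
      where
      v∉F : v ∉ F
      v∉F v∈F = v∉F∩S (x∈p∩q⁺ (v∈F , v∈S))
      same : ∀ {u} → G ⊢ v ∼ u → u ∈ F ⇔ u ∈ F ∩ S
      same {u} v∼u = mk⇔ (λ u∈F → x∈p∩q⁺ (u∈F , closed v∈S v∼u u≢b)) (p∩q⊆p F S)
        where
        u≢b : u ≢ b
        u≢b refl = v∉F (attached∈F v∈S v∼u)

  data Walk : Fin n → List (Fin n) → Fin n → Set where
    []  : ∀ {x} → Walk x [] x
    _∷_ : ∀ {x z l y} → G ⊢ x ∼ z → Walk z l y → Walk x (z ∷ l) y

  Walk⇒IsWalk : ∀ {x l y} → Walk x l y → IsWalk G (x ∷ l)
  Walk⇒IsWalk []        = single _
  Walk⇒IsWalk (x∼z ∷ w) = step x∼z (Walk⇒IsWalk w)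

  last-Walk : ∀ {x l y} → Walk x l y → last (x ∷ l) ≡ just y
  last-Walk []      = refl
  last-Walk (_ ∷ w) = last-Walk w

  Path : ∀ {ℓ} → Pred (Fin n) ℓ → Fin n → Fin n → Set ℓ
  Path P x y = ∃[ l ] (Walk x l y × Unique (x ∷ l) × All P (x ∷ l))

  module _ {ℓ} {P : Pred (Fin n) ℓ} where

    suffixPath : ∀ {x z l y} → Walk z l y → Unique (z ∷ l) → All P (z ∷ l) → x List.∈ z ∷ l → Path P x y
    suffixPath w       unique       ps       (here refl) = _ , w , unique , ps
    suffixPath (_ ∷ w) (_ ∷ unique) (_ ∷ ps) (there x∈l) = suffixPath w unique ps x∈l

    loopErase : ∀ {x l y} → Walk x l y → All P (x ∷ l) → Path P x y
    loopErase []        ps = [] , [] , [] ∷ [] , ps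
    loopErase {x} (_∷_ {z = z} x∼z w) (px ∷ ps) with loopErase w ps
    ... | l′ , w′ , unique , ps′ with Any.any? (x ≟_) (z ∷ l′)
    ... | yes x∈ = suffixPath w′ unique ps′ x∈
    ... | no x∉  = _ , x∼z ∷ w′ , ¬Any⇒All¬ _ x∉ ∷ unique , px ∷ ps′

module Branches {n} (G : Graph n) (b : Fin n) (connected : Connected G) (acyclic : Acyclic G) where

  infix 4 _—_ _⇝_

  _—_ : Rel (Fin n) 0ℓ
  u — v = G ⊢ u ∼ v × u ≢ b × v ≢ b

  —-sym : Symmetric _—_
  —-sym (u∼v , u≢b , v≢b) = ∼-sym G u∼v , v≢b , u≢b

  _⇝_ : Rel (Fin n) 0ℓ
  _⇝_ = Star _—_

  ⇝⇒Walk : ∀ {x y} → x ≢ b → x ⇝ y → ∃[ l ] (Walk G x l y × All (_≢ b) (x ∷ l))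
  ⇝⇒Walk x≢b ε = [] , [] , x≢b ∷ []
  ⇝⇒Walk x≢b ((x∼z , _ , z≢b) ◅ p) =
    let l , w , avoid = ⇝⇒Walk z≢b p in _ , x∼z ∷ w , x≢b ∷ avoid

  neighbours-⇝⇒≡ : ∀ {x y} → G ⊢ x ∼ b → G ⊢ y ∼ b → x ⇝ y → x ≡ y
  neighbours-⇝⇒≡ {x} {y} x∼b y∼b p with x ≟ y
  ... | yes x≡y = x≡y
  ... | no x≢y with ⇝⇒Walk (∼⇒≢ G x∼b) p
  ... | _ , w , avoid with loopErase G w avoid
  ... | l , w′ , unique , avoid′ = ⊥-elim (acyclic (b ∷ x ∷ l) cycle)
    where
    long : Walk G x l y → 3 ≤ length (b ∷ x ∷ l)
    long []      = contradiction refl x≢y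
    long (_ ∷ _) = s≤s (s≤s (s≤s z≤n))
    cycle : IsCycle G (b ∷ x ∷ l)
    cycle = step (∼-sym G x∼b) (Walk⇒IsWalk G w′) , All.map ≢-sym avoid′ ∷ unique
          , long w′ , y , last-Walk G w′ , y∼b

  walk⇒⇝-neighbour : ∀ {v l} → IsWalk G (v ∷ l) → last (v ∷ l) ≡ just b → v ≢ b →
    ∃[ r ] (G ⊢ r ∼ b × v ⇝ r)
  walk⇒⇝-neighbour (single v) last≡b v≢b = contradiction (just-injective last≡b) v≢b
  walk⇒⇝-neighbour (step {y = z} v∼z w) last≡b v≢b with z ≟ b
  ... | yes refl = _ , v∼z , ε
  ... | no z≢b   = let r , r∼b , p = walk⇒⇝-neighbour w last≡b z≢b in
    r , r∼b , (v∼z , v≢b , z≢b) ◅ p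

  ⇝-neighbour : ∀ {v} → v ≢ b → ∃[ r ] (G ⊢ r ∼ b × v ⇝ r)
  ⇝-neighbour {v} v≢b with connected v b
  ... | [] , _ , () , _
  ... | _ ∷ _ , w , refl , last≡b = walk⇒⇝-neighbour w last≡b v≢b

  -- root b = b is a junk value.
  root : Fin n → Fin n
  root v with v ≟ b
  ... | yes _   = b
  ... | no v≢b = proj₁ (⇝-neighbour v≢b)

  root-spec : ∀ {v} → v ≢ b → G ⊢ root v ∼ b × v ⇝ root v
  root-spec {v} v≢b with v ≟ b
  ... | yes v≡b  = contradiction v≡b v≢b
  ... | no v≢b′ = proj₂ (⇝-neighbour v≢b′)

  root-unique : ∀ {v r} → v ≢ b → G ⊢ r ∼ b → v ⇝ r → root v ≡ r
  root-unique v≢b r∼b p =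
    let root∼b , toRoot = root-spec v≢b in neighbours-⇝⇒≡ root∼b r∼b (reverse —-sym toRoot ◅◅ p)

  root-neighbour : ∀ {v} → G ⊢ v ∼ b → root v ≡ v
  root-neighbour v∼b = root-unique (∼⇒≢ G v∼b) v∼b ε

  root-edge : ∀ {u v} → u — v → root u ≡ root v
  root-edge u—v@(_ , u≢b , v≢b) =
    let root∼b , toRoot = root-spec v≢b in root-unique u≢b root∼b (u—v ◅ toRoot)

  RootedIn : Subset n → Pred (Fin n) 0ℓ
  RootedIn F v = v ≢ b × root v ∈ F

  rootedIn? : ∀ F → Decidable (RootedIn F)
  rootedIn? F v = ¬? (v ≟ b) ×-dec root v ∈? F

  branches : Subset n → Subset n
  branches F = subsetOf (rootedIn? F)

  b∉branches : ∀ {F} → b ∉ branches F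
  b∉branches {F} b∈ = proj₁ (∈-subsetOf⁻ (rootedIn? F) b∈) refl

  branches-closed : ∀ {F u v} → u ∈ branches F → G ⊢ u ∼ v → v ≢ b → v ∈ branches F
  branches-closed {F} u∈ u∼v v≢b =
    let u≢b , root∈F = ∈-subsetOf⁻ (rootedIn? F) u∈ in
    ∈-subsetOf⁺ (rootedIn? F) (v≢b , subst (_∈ F) (root-edge (u∼v , u≢b , v≢b)) root∈F)

  attached∈F : ∀ {F v} → v ∈ branches F → G ⊢ v ∼ b → v ∈ F
  attached∈F {F} v∈ v∼b = subst (_∈ F) (root-neighbour v∼b) (proj₂ (∈-subsetOf⁻ (rootedIn? F) v∈))

  neighbour∈branches : ∀ {F v} → G ⊢ v ∼ b → v ∈ F → v ∈ branches F
  neighbour∈branches {F} v∼b v∈F =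
    ∈-subsetOf⁺ (rootedIn? F) (∼⇒≢ G v∼b , subst (_∈ F) (≡.sym (root-neighbour v∼b)) v∈F)

corollary9 : ∀ {n} (T : Graph n) → IsTree T → (F : Subset n) → IsMinimalFort T F →
    ∀ (a b c : Fin n) → a ≢ c → ¬ (a ∈ F × b ∈ F × c ∈ F × T ⊢ a ∼ b × T ⊢ b ∼ c)
corollary9 T (_ , connected , acyclic) F (fort , minimal) a b c a≢c (a∈F , b∈F , c∈F , a∼b , b∼c) =
  minimal (F ∩ B) (p∩q⊆p F B , b , b∈F , b∉F∩B)
    (∩-isFort T fort branches-closed attached∈F (a , a∈F∩B) (inj₂ (2≤nbrsIn T a≢c (∼-sym T a∼b) b∼c a∈F∩B c∈F∩B)))
  where
  open Branches T b connected acyclic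
  B : Subset _
  B = branches F
  a∈F∩B : a ∈ F ∩ B
  a∈F∩B = x∈p∩q⁺ (a∈F , neighbour∈branches a∼b a∈F)
  c∈F∩B : c ∈ F ∩ B
  c∈F∩B = x∈p∩q⁺ (c∈F , neighbour∈branches (∼-sym T b∼c) c∈F)
  b∉F∩B : b ∉ F ∩ B
  b∉F∩B = b∉branches ∘ proj₂ ∘ x∈p∩q⁻ F B
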